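{- Let $a\geq 2$ and let $\gamma=(a,a-1,\gamma_3,\ldots,\gamma_r)$ be a partition such that $(a-1,\gamma_3,\ldots,\gamma_r)$ is a sign partition and $\gamma_3+\cdots+\gamma_r\leq a$. If $\beta$ is a partition of $|\gamma|$ with $\chi^\beta_\gamma\notin\{0,1,-1\}$, then $\beta$ has two $a$-hooks (nodes of hook length $a$), and for every partition $\delta$ obtained from $\beta$ by removing an $a$-hook (i.e. the rim hook associated to a node of hook length $a$) we have $\chi^\delta_{(a-1,\gamma_3,\ldots,\gamma_r)}\neq 0$; in particular each such $\delta$ has an $(a-1)$-hook.
   Context: A partition $\gamma$ of $n$ is a sign partition if every irreducible character of the symmetric group $S_n$ takes a value in $\{0,1,-1\}$ on the permutations of cycle type $\gamma$. $|\lambda|$ is the sum of the parts of $\lambda$. For partitions $\lambda,\mu$ of the same $n$, $\chi^\lambda_\mu$ is the value of the irreducible character of $S_n$ labeled by $\lambda$ on permutations of cycle type $\mu$. A $q$-hook of $\lambda$ is a node of its Young diagram with hook length $q$; removing it means removing the corresponding rim hook (border strip) of length $q$. -}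

module Defs where

open import Data.Nat as ℕ using (ℕ; zero; suc; _+_; _∸_; _≤_; _<_; _<ᵇ_; _≡ᵇ_)
open import Data.Bool using (Bool; true; false; if_then_else_)
open import Data.List using (List; []; _∷_; length; filter; map; concatMap; upTo; foldr)
open import Data.Nat.ListAction using (sum)
open import Data.List.Relation.Unary.All using (All)
open import Data.List.Relation.Unary.Linked using (Linked)
open import Data.Integer as ℤ using (ℤ)
open import Data.Product using (_×_; Σ; ∃; _,_)
open import Data.Sum using (_⊎_)
open import Relation.Binary.PropositionalEquality using (_≡_)
open import Relation.Nullary using (¬_)

IsPartition : List ℕ → Set
IsPartition λ′ = Linked ℕ._≥_ λ′ × All (λ x → 0 < x) λ′

∣_∣ : List ℕ → ℕ
∣ λ′ ∣ = sum λ′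

-- i-th part (0-indexed), 0 when out of range
at : List ℕ → ℕ → ℕ
at []       _       = 0
at (x ∷ _)  zero    = x
at (_ ∷ xs) (suc i) = at xs i

-- λ'_j : length of column j (0-indexed) = number of parts > j
col : List ℕ → ℕ → ℕ
col λ′ j = length (filter (λ x → j ℕ.<? x) λ′)

-- Nodes of the Young diagram: (i , j) with i = row, j = column, 0-indexed.
Node : List ℕ → ℕ × ℕ → Set
Node λ′ (i , j) = j < at λ′ i

arm : List ℕ → ℕ → ℕ → ℕ
arm λ′ i j = at λ′ i ∸ suc j

leg : List ℕ → ℕ → ℕ → ℕ
leg λ′ i j = col λ′ j ∸ suc i

hook : List ℕ → ℕ → ℕ → ℕ
hook λ′ i j = suc (arm λ′ i j + leg λ′ i j)

removeRim : List ℕ → ℕ → ℕ → List ℕ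
removeRim λ′ i j = filter (λ x → 0 ℕ.<? x) (map row (upTo (length λ′)))
  where
  L = leg λ′ i j
  row : ℕ → ℕ
  row r = if r <ᵇ i then at λ′ r
          else if r <ᵇ i + L then at λ′ (suc r) ∸ 1
          else if r ≡ᵇ i + L then j
          else at λ′ r

nodes : List ℕ → List (ℕ × ℕ)
nodes λ′ = concatMap (λ i → map (λ j → (i , j)) (upTo (at λ′ i))) (upTo (length λ′))

sign : ℕ → ℤ
sign zero    = ℤ.1ℤ
sign (suc n) = ℤ.- sign n

isEmpty : List ℕ → Bool
isEmpty [] = true
isEmpty (_ ∷ _) = false

-- Irreducible character values χ^λ_μ of the symmetric group, defined by
-- the Murnaghan–Nakayama rule:
--   χ^∅_∅ = 1,
--   χ^λ_{(q, μ₂, …)} = Σ_{nodes (i,j) of λ with hook length q}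
--                        (-1)^{leg(i,j)} χ^{λ ∖ rim(i,j)}_{(μ₂, …)}.

χ : List ℕ → List ℕ → ℤ
χ λ′ []      = if isEmpty λ′ then ℤ.1ℤ else ℤ.0ℤ
χ λ′ (q ∷ μ) = foldr ℤ._+_ ℤ.0ℤ (map term (nodes λ′))
  where
  term : ℕ × ℕ → ℤ
  term (i , j) = if hook λ′ i j ≡ᵇ q
                 then sign (leg λ′ i j) ℤ.* χ (removeRim λ′ i j) μ
                 else ℤ.0ℤ

InSign : ℤ → Set
InSign v = v ≡ ℤ.0ℤ ⊎ v ≡ ℤ.1ℤ ⊎ v ≡ ℤ.-1ℤ

SignPartition : List ℕ → Set
SignPartition γ = IsPartition γ ×
  ((λ′ : List ℕ) → IsPartition λ′ → ∣ λ′ ∣ ≡ ∣ γ ∣ → InSign (χ λ′ γ))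

hookAt : List ℕ → ℕ × ℕ → ℕ
hookAt λ′ (i , j) = hook λ′ i j

removeAt : List ℕ → ℕ × ℕ → List ℕ
removeAt λ′ (i , j) = removeRim λ′ i j

-- Write γ = (a, γ′).  By the Murnaghan–Nakayama rule χ^β_γ is a sum, over the a-hooks of β, of
-- ± χ^δ_γ′ with δ the partition left by removing the rim hook; as γ′ is a sign partition each
-- summand lies in {0, ±1}, so β has at least two a-hooks.  Distinct nodes with the same hook
-- length lie strictly north-east of one another (hook lengths drop along rows and columns), and
-- the hook lengths of three such nodes add up to at most |β| < 3a, so β has exactly two a-hooks.
-- If removing one of them gave χ^δ_γ′ = 0, χ^β_γ would be the other summand, in {0, ±1}.
-- Finally χ^δ_γ′ ≠ 0 forces an (a - 1)-hook in δ, since otherwise the Murnaghan–Nakayama sum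
-- for χ^δ_γ′ is empty.
module Submission where

open import Algebra.Properties.CommutativeSemigroup using (interchange)
open import Data.Bool using (true; false; if_then_else_)
open import Data.Empty using (⊥; ⊥-elim)
open import Data.Integer as ℤ using (ℤ; 0ℤ)
import Data.Integer.Properties as ℤ
open import Data.List using (List; []; _∷_; length; filter; map; foldr; upTo; applyUpTo)
open import Data.List.Membership.Propositional using (_∈_; find; lose)
open import Data.List.Membership.Propositional.Properties
  using (∈-map⁺; ∈-map⁻; ∈-upTo⁺; ∈-upTo⁻; ∈-concatMap⁺; ∈-concatMap⁻; ∈-filter⁺; ∈-filter⁻)
open import Data.List.Properties using (map-upTo; length-filter)
open import Data.List.Relation.Binary.Disjoint.Propositional using (Disjoint)
open import Data.List.Relation.Unary.All as All using (All; []; _∷_)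
import Data.List.Relation.Unary.All.Properties as All
open import Data.List.Relation.Unary.AllPairs using (AllPairs; _∷_)
import Data.List.Relation.Unary.AllPairs.Properties as AllPairs
open import Data.List.Relation.Unary.Any using (Any; here; there)
open import Data.List.Relation.Unary.Linked as Linked using (Linked; _∷_)
import Data.List.Relation.Unary.Linked.Properties as Linked
open import Data.List.Relation.Unary.Unique.Propositional using (Unique)
import Data.List.Relation.Unary.Unique.Propositional.Properties as Unique
open import Data.Nat as ℕ
  using (ℕ; zero; suc; _+_; _*_; _∸_; _≤_; _<_; _≥_; _>_; z≤n; s≤s; s≤s⁻¹; _<ᵇ_; _≡ᵇ_)
open import Data.Nat.ListAction using (sum)
open import Data.Nat.Properties
open import Data.Nat.Tactic.RingSolver using (solve-∀)
open import Data.Product using (_×_; _,_; proj₁; proj₂; Σ-syntax)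
open import Data.Sum using (_⊎_; inj₁; inj₂)
open import Function using (_∘_; flip)
open import Relation.Binary using (Tri; tri<; tri≈; tri>)
open import Relation.Binary.PropositionalEquality
open import Relation.Nullary using (¬_; Dec; yes; no; does)
open import Relation.Nullary.Decidable using (dec-true; dec-false)

open import Defs

⟦_⟧ : ∀ {p} {P : Set p} → Dec P → ℕ
⟦ d ⟧ = if does d then 1 else 0

⟦⟧≤1 : ∀ {p} {P : Set p} (d : Dec P) → ⟦ d ⟧ ≤ 1
⟦⟧≤1 (yes _) = s≤s z≤n
⟦⟧≤1 (no  _) = z≤n

⟦⟧-yes : ∀ {p} {P : Set p} (d : Dec P) → P → ⟦ d ⟧ ≡ 1
⟦⟧-yes d p = cong (if_then 1 else 0) (dec-true d p)

⟦⟧-no : ∀ {p} {P : Set p} (d : Dec P) → ¬ P → ⟦ d ⟧ ≡ 0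
⟦⟧-no d ¬p = cong (if_then 1 else 0) (dec-false d ¬p)

⟦⟧-mono : ∀ {p q} {P : Set p} {Q : Set q} → (Q → P) → (P? : Dec P) (Q? : Dec Q) → ⟦ Q? ⟧ ≤ ⟦ P? ⟧
⟦⟧-mono Q⇒P P?      (no  _) = z≤n
⟦⟧-mono Q⇒P (yes _) (yes _) = ≤-refl
⟦⟧-mono Q⇒P (no ¬p) (yes q) = ⊥-elim (¬p (Q⇒P q))

<ᵇ-true : ∀ {m n} → m < n → (m <ᵇ n) ≡ true
<ᵇ-true = dec-true (_ <? _)

<ᵇ-false : ∀ {m n} → n ≤ m → (m <ᵇ n) ≡ false
<ᵇ-false n≤m = dec-false (_ <? _) (≤⇒≯ n≤m)

∑ : ℕ → (ℕ → ℕ) → ℕ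
∑ n f = sum (applyUpTo f n)

∑-cong : ∀ n {f g : ℕ → ℕ} → (∀ {k} → k < n → f k ≡ g k) → ∑ n f ≡ ∑ n g
∑-cong zero    eq = refl
∑-cong (suc n) eq = cong₂ _+_ (eq (s≤s z≤n)) (∑-cong n (eq ∘ s≤s))

∑-mono-≤ : ∀ n {f g : ℕ → ℕ} → (∀ k → f k ≤ g k) → ∑ n f ≤ ∑ n g
∑-mono-≤ zero    le = z≤n
∑-mono-≤ (suc n) le = +-mono-≤ (le 0) (∑-mono-≤ n (le ∘ suc))

∑-+ : ∀ n (f g : ℕ → ℕ) → ∑ n (λ k → f k + g k) ≡ ∑ n f + ∑ n g
∑-+ zero    f g = refl
∑-+ (suc n) f g = trans (cong (f 0 + g 0 +_) (∑-+ n (f ∘ suc) (g ∘ suc)))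
                        (interchange +-commutativeSemigroup (f 0) (g 0) _ _)

∑-+₃ : ∀ n (f g h : ℕ → ℕ) → ∑ n (λ k → f k + g k + h k) ≡ ∑ n f + ∑ n g + ∑ n h
∑-+₃ n f g h = trans (∑-+ n (λ k → f k + g k) h) (cong (_+ ∑ n h) (∑-+ n f g))

∑-split : ∀ m n (f : ℕ → ℕ) → ∑ (m + n) f ≡ ∑ m f + ∑ n (λ k → f (m + k))
∑-split zero    n f = refl
∑-split (suc m) n f = trans (cong (f 0 +_) (∑-split m n (f ∘ suc))) (sym (+-assoc (f 0) _ _))

∑-pred : ∀ n (f : ℕ → ℕ) → (∀ {k} → k < n → 0 < f k) → ∑ n (λ k → f k ∸ 1) + n ≡ ∑ n f
∑-pred zero    f pos = refl
∑-pred (suc n) f pos = begin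
  f 0 ∸ 1 + ∑ n (λ k → f (suc k) ∸ 1) + suc n   ≡⟨ +-suc _ n ⟩
  suc (f 0 ∸ 1 + ∑ n (λ k → f (suc k) ∸ 1) + n) ≡⟨ cong suc (+-assoc (f 0 ∸ 1) _ n) ⟩
  suc (f 0 ∸ 1) + (∑ n (λ k → f (suc k) ∸ 1) + n) ≡⟨ cong₂ _+_ (suc-pred (f 0) ⦃ ℕ.>-nonZero (pos (s≤s z≤n)) ⦄)
                                                                (∑-pred n (f ∘ suc) (pos ∘ s≤s)) ⟩
  f 0 + ∑ n (f ∘ suc)                           ∎
  where open ≡-Reasoning

∑-select : ∀ {n i} (f : ℕ → ℕ) → i < n → ∑ n (λ r → ⟦ r ≟ i ⟧ * f r) ≡ f i
∑-select {suc n} {zero}  f _ = trans (cong (f 0 + 0 +_) (∑-zero n)) (trans (+-identityʳ _) (+-identityʳ _))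
  where
  ∑-zero : ∀ n → ∑ n (λ _ → 0) ≡ 0
  ∑-zero zero    = refl
  ∑-zero (suc n) = ∑-zero n
∑-select {suc n} {suc i} f (s≤s i<n) = ∑-select (f ∘ suc) i<n

∑-select₃ : ∀ {n i₁ i₂ i₃} (f : ℕ → ℕ) → i₁ < n → i₂ < n → i₃ < n →
            ∑ n (λ r → (⟦ r ≟ i₁ ⟧ + ⟦ r ≟ i₂ ⟧ + ⟦ r ≟ i₃ ⟧) * f r) ≡ f i₁ + f i₂ + f i₃
∑-select₃ {n} {i₁} {i₂} {i₃} f i₁<n i₂<n i₃<n = begin
  ∑ n (λ r → (⟦ r ≟ i₁ ⟧ + ⟦ r ≟ i₂ ⟧ + ⟦ r ≟ i₃ ⟧) * f r)
    ≡⟨ ∑-cong n (λ {r} _ → distrib ⟦ r ≟ i₁ ⟧ ⟦ r ≟ i₂ ⟧ ⟦ r ≟ i₃ ⟧ (f r)) ⟩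
  ∑ n (λ r → ⟦ r ≟ i₁ ⟧ * f r + ⟦ r ≟ i₂ ⟧ * f r + ⟦ r ≟ i₃ ⟧ * f r)
    ≡⟨ ∑-+₃ n _ _ _ ⟩
  ∑ n (λ r → ⟦ r ≟ i₁ ⟧ * f r) + ∑ n (λ r → ⟦ r ≟ i₂ ⟧ * f r) + ∑ n (λ r → ⟦ r ≟ i₃ ⟧ * f r)
    ≡⟨ cong₂ _+_ (cong₂ _+_ (∑-select f i₁<n) (∑-select f i₂<n)) (∑-select f i₃<n) ⟩
  f i₁ + f i₂ + f i₃ ∎
  where
  open ≡-Reasoning
  distrib : ∀ a b c x → (a + b + c) * x ≡ a * x + b * x + c * x
  distrib = solve-∀

-- Both sides compute by cases on j <ᵇ x, which is what ⟦ j <? x ⟧ and the filter in col reduce to.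
col-∷ : ∀ x xs j → col (x ∷ xs) j ≡ ⟦ j <? x ⟧ + col xs j
col-∷ x xs j with j <ᵇ x
... | true  = refl
... | false = refl

col-∷-< : ∀ {x} xs {j} → j < x → col (x ∷ xs) j ≡ suc (col xs j)
col-∷-< {x} xs {j} j<x = trans (col-∷ x xs j) (cong (_+ col xs j) (⟦⟧-yes (j <? x) j<x))

col-∷-≥ : ∀ {x} xs {j} → x ≤ j → col (x ∷ xs) j ≡ col xs j
col-∷-≥ {x} xs {j} x≤j = trans (col-∷ x xs j) (cong (_+ col xs j) (⟦⟧-no (j <? x) (≤⇒≯ x≤j)))

col-antitone : ∀ λ′ {j j′} → j ≤ j′ → col λ′ j′ ≤ col λ′ j
col-antitone []       j≤j′ = z≤n
col-antitone (x ∷ xs) {j} {j′} j≤j′ = begin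
  col (x ∷ xs) j′            ≡⟨ col-∷ x xs j′ ⟩
  ⟦ j′ <? x ⟧ + col xs j′    ≤⟨ +-mono-≤ (⟦⟧-mono (≤-<-trans j≤j′) (j <? x) (j′ <? x)) (col-antitone xs j≤j′) ⟩
  ⟦ j <? x ⟧ + col xs j      ≡⟨ col-∷ x xs j ⟨
  col (x ∷ xs) j             ∎
  where open ≤-Reasoning

∑-at : ∀ λ′ → ∑ (length λ′) (at λ′) ≡ ∣ λ′ ∣
∑-at []       = refl
∑-at (x ∷ xs) = cong (x +_) (∑-at xs)

∑-col : ∀ λ′ j → ∑ (length λ′) (λ r → ⟦ j <? at λ′ r ⟧) ≡ col λ′ j
∑-col []       j = refl
∑-col (x ∷ xs) j = trans (cong (⟦ j <? x ⟧ +_) (∑-col xs j)) (sym (col-∷ x xs j))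

<at⇒<length : ∀ λ′ {i j} → j < at λ′ i → i < length λ′
<at⇒<length (x ∷ xs) {zero}  _ = s≤s z≤n
<at⇒<length (x ∷ xs) {suc i} j<at = s≤s (<at⇒<length xs j<at)

at-antitone : ∀ {λ′} → Linked _≥_ λ′ → ∀ {r s} → r ≤ s → at λ′ s ≤ at λ′ r
at-antitone {[]}         _            _                   = z≤n
at-antitone {x ∷ xs}     _            {s = zero}  z≤n     = ≤-refl
at-antitone {x ∷ []}     _            {s = suc s} z≤n     = z≤n
at-antitone {x ∷ y ∷ ys} (x≥y ∷ desc) {s = suc s} z≤n     = ≤-trans (at-antitone desc {s = s} z≤n) x≥y
at-antitone {x ∷ xs}     desc         (s≤s r≤s)           = at-antitone (Linked.tail desc) r≤s

at≤head : ∀ {x xs} → Linked _≥_ (x ∷ xs) → ∀ r → at xs r ≤ x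
at≤head desc r = at-antitone desc {0} {suc r} z≤n

<at⇒<col : ∀ {λ′} → Linked _≥_ λ′ → ∀ {r j} → j < at λ′ r → r < col λ′ j
<at⇒<col {x ∷ xs} desc {zero}  j<x  = subst (0 <_) (sym (col-∷-< xs j<x)) (s≤s z≤n)
<at⇒<col {x ∷ xs} desc {suc r} j<at = subst (suc r <_) (sym (col-∷-< xs (<-≤-trans j<at (at≤head desc r))))
                                           (s≤s (<at⇒<col (Linked.tail desc) j<at))

<col⇒<at : ∀ {λ′} → Linked _≥_ λ′ → ∀ {r j} → r < col λ′ j → j < at λ′ r
<col⇒<at {x ∷ xs} desc {r} {j} r<col with j <? x | r
... | yes j<x | zero  = j<x
... | yes j<x | suc r = <col⇒<at (Linked.tail desc) (s≤s⁻¹ (subst (suc r <_) (col-∷-< xs j<x) r<col))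
... | no  j≮x | r     = ⊥-elim (j≮x (<-≤-trans (<col⇒<at (Linked.tail desc) r<col′) (at≤head desc r)))
  where
  r<col′ : r < col xs j
  r<col′ = subst (r <_) (col-∷-≥ xs (≮⇒≥ j≮x)) r<col

hook-identity : ∀ {λ′} → Linked _≥_ λ′ → ∀ {i j} → Node λ′ (i , j) →
                hook λ′ i j + suc (i + j) ≡ at λ′ i + col λ′ j
hook-identity {λ′} desc {i} {j} node = begin
  hook λ′ i j + suc (i + j)                   ≡⟨ regroup (arm λ′ i j) (leg λ′ i j) i j ⟩
  (arm λ′ i j + suc j) + (leg λ′ i j + suc i) ≡⟨ cong₂ _+_ (m∸n+n≡m node) (m∸n+n≡m (<at⇒<col desc node)) ⟩
  at λ′ i + col λ′ j                          ∎
  where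
  open ≡-Reasoning
  regroup : ∀ a l i j → suc (a + l) + suc (i + j) ≡ (a + suc j) + (l + suc i)
  regroup = solve-∀

hook-< : ∀ {λ′} → Linked _≥_ λ′ → ∀ {i j i′ j′} → Node λ′ (i , j) → Node λ′ (i′ , j′) →
         i ≤ i′ → j ≤ j′ → i + j < i′ + j′ → hook λ′ i′ j′ < hook λ′ i j
hook-< {λ′} desc {i} {j} {i′} {j′} node node′ i≤i′ j≤j′ ij<i′j′ = +-cancelʳ-< (suc (i + j)) _ _ (begin-strict
  hook λ′ i′ j′ + suc (i + j)    <⟨ +-monoʳ-< (hook λ′ i′ j′) (s≤s ij<i′j′) ⟩
  hook λ′ i′ j′ + suc (i′ + j′)  ≡⟨ hook-identity desc node′ ⟩
  at λ′ i′ + col λ′ j′           ≤⟨ +-mono-≤ (at-antitone desc i≤i′) (col-antitone λ′ j≤j′) ⟩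
  at λ′ i + col λ′ j             ≡⟨ hook-identity desc node ⟨
  hook λ′ i j + suc (i + j)      ∎)
  where open ≤-Reasoning

_≺_ : ℕ × ℕ → ℕ × ℕ → Set
(i , j) ≺ (i′ , j′) = i < i′ × j′ < j

≡-hook⇒≺⊎≻ : ∀ {λ′} → Linked _≥_ λ′ → ∀ {p q} → Node λ′ p → Node λ′ q →
             hookAt λ′ p ≡ hookAt λ′ q → p ≢ q → p ≺ q ⊎ q ≺ p
≡-hook⇒≺⊎≻ desc {i , j} {i′ , j′} node node′ h≡h′ p≢q = compare (<-cmp i i′) (<-cmp j j′)
  where
  below : i ≤ i′ → j ≤ j′ → i + j < i′ + j′ → ⊥
  below i≤i′ j≤j′ lt = <-irrefl (sym h≡h′) (hook-< desc node node′ i≤i′ j≤j′ lt)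
  above : i′ ≤ i → j′ ≤ j → i′ + j′ < i + j → ⊥
  above i′≤i j′≤j lt = <-irrefl h≡h′ (hook-< desc node′ node i′≤i j′≤j lt)
  compare : Tri (i < i′) (i ≡ i′) (i > i′) → Tri (j < j′) (j ≡ j′) (j > j′) →
            (i , j) ≺ (i′ , j′) ⊎ (i′ , j′) ≺ (i , j)
  compare (tri< i<i′ _ _) (tri> _ _ j>j′) = inj₁ (i<i′ , j>j′)
  compare (tri> _ _ i>i′) (tri< j<j′ _ _) = inj₂ (i>i′ , j<j′)
  compare (tri< i<i′ _ _) (tri< j<j′ _ _) = ⊥-elim (below (<⇒≤ i<i′) (<⇒≤ j<j′) (+-mono-< i<i′ j<j′))
  compare (tri< i<i′ _ _) (tri≈ _ refl _) = ⊥-elim (below (<⇒≤ i<i′) ≤-refl (+-monoˡ-< j i<i′))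
  compare (tri≈ _ refl _) (tri< j<j′ _ _) = ⊥-elim (below ≤-refl (<⇒≤ j<j′) (+-monoʳ-< i j<j′))
  compare (tri≈ _ refl _) (tri≈ _ refl _) = ⊥-elim (p≢q refl)
  compare (tri≈ _ refl _) (tri> _ _ j>j′) = ⊥-elim (above ≤-refl (<⇒≤ j>j′) (+-monoʳ-< i j>j′))
  compare (tri> _ _ i>i′) (tri≈ _ refl _) = ⊥-elim (above (<⇒≤ i>i′) ≤-refl (+-monoˡ-< j i>i′))
  compare (tri> _ _ i>i′) (tri> _ _ j>j′) = ⊥-elim (above (<⇒≤ i>i′) (<⇒≤ j>j′) (+-mono-< i>i′ j>j′))

wlog-chain₃ : ∀ {a p ℓ b} {A : Set a} {P : A → Set p} {_⊏_ : A → A → Set ℓ} {B : Set b} →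
              (∀ {x y z} → P x → P y → P z → x ⊏ y → y ⊏ z → B) →
              ∀ {x y z} → P x → P y → P z → x ⊏ y ⊎ y ⊏ x → y ⊏ z ⊎ z ⊏ y → x ⊏ z ⊎ z ⊏ x → B
wlog-chain₃ sorted px py pz (inj₁ x⊏y) (inj₁ y⊏z) _          = sorted px py pz x⊏y y⊏z
wlog-chain₃ sorted px py pz (inj₁ x⊏y) (inj₂ z⊏y) (inj₁ x⊏z) = sorted px pz py x⊏z z⊏y
wlog-chain₃ sorted px py pz (inj₁ x⊏y) (inj₂ z⊏y) (inj₂ z⊏x) = sorted pz px py z⊏x x⊏y
wlog-chain₃ sorted px py pz (inj₂ y⊏x) (inj₁ y⊏z) (inj₁ x⊏z) = sorted py px pz y⊏x x⊏z
wlog-chain₃ sorted px py pz (inj₂ y⊏x) (inj₁ y⊏z) (inj₂ z⊏x) = sorted py pz px y⊏z z⊏x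
wlog-chain₃ sorted px py pz (inj₂ y⊏x) (inj₂ z⊏y) _          = sorted pz py px z⊏y y⊏x

count-below≤ : ∀ {j₁ j₂ j₃ x} → j₃ < j₂ → j₂ < j₁ →
               (d₁ : Dec (j₁ < x)) (d₂ : Dec (j₂ < x)) (d₃ : Dec (j₃ < x)) → ⟦ d₁ ⟧ + ⟦ d₂ ⟧ + ⟦ d₃ ⟧ ≤ x
count-below≤ {j₁} {j₂} {j₃} j₃<j₂ j₂<j₁ = count
  where
  1≤j₂ : 1 ≤ j₂
  1≤j₂ = <-≤-trans (s≤s z≤n) j₃<j₂
  count : ∀ {x} (d₁ : Dec (j₁ < x)) (d₂ : Dec (j₂ < x)) (d₃ : Dec (j₃ < x)) → ⟦ d₁ ⟧ + ⟦ d₂ ⟧ + ⟦ d₃ ⟧ ≤ x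
  count (yes j₁<x) d₂ d₃         = ≤-trans (s≤s (+-mono-≤ (⟦⟧≤1 d₂) (⟦⟧≤1 d₃))) (<-≤-trans (s≤s (<-≤-trans (s≤s 1≤j₂) j₂<j₁)) j₁<x)
  count (no _) (yes j₂<x) d₃     = ≤-trans (s≤s (⟦⟧≤1 d₃)) (<-≤-trans (s≤s 1≤j₂) j₂<x)
  count (no _) (no _) (yes j₃<x) = <-≤-trans (s≤s z≤n) j₃<x
  count (no _) (no _) (no _)     = z≤n

multiplicity≤1 : ∀ {r i₁ i₂ i₃ : ℕ} → i₁ ≢ i₂ → i₁ ≢ i₃ → i₂ ≢ i₃ →
                 (d₁ : Dec (r ≡ i₁)) (d₂ : Dec (r ≡ i₂)) (d₃ : Dec (r ≡ i₃)) → ⟦ d₁ ⟧ + ⟦ d₂ ⟧ + ⟦ d₃ ⟧ ≤ 1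
multiplicity≤1 i₁≢i₂ _     _     (yes refl) (yes refl) _          = ⊥-elim (i₁≢i₂ refl)
multiplicity≤1 _     i₁≢i₃ _     (yes refl) (no _)     (yes refl) = ⊥-elim (i₁≢i₃ refl)
multiplicity≤1 _     _     i₂≢i₃ (no _)     (yes refl) (yes refl) = ⊥-elim (i₂≢i₃ refl)
multiplicity≤1 _     _     _     (yes _)    (no _)     (no _)     = ≤-refl
multiplicity≤1 _     _     _     (no _)     (yes _)    (no _)     = ≤-refl
multiplicity≤1 _     _     _     (no _)     (no _)     (yes _)    = ≤-refl
multiplicity≤1 _     _     _     (no _)     (no _)     (no _)     = z≤n

-- Counted row by row: a chosen row meets at most the 3 chosen columns, and any other row r meets
-- at most at λ′ r of them because j₃ < j₂ < j₁.
rows+cols≤ : ∀ λ′ {i₁ i₂ i₃ j₁ j₂ j₃} → i₁ < i₂ → i₂ < i₃ → i₃ < length λ′ → j₃ < j₂ → j₂ < j₁ →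
             (at λ′ i₁ + at λ′ i₂ + at λ′ i₃) + (col λ′ j₁ + col λ′ j₂ + col λ′ j₃) ≤ ∣ λ′ ∣ + 9
rows+cols≤ λ′ {i₁} {i₂} {i₃} {j₁} {j₂} {j₃} i₁<i₂ i₂<i₃ i₃<n j₃<j₂ j₂<j₁ = begin
  (at λ′ i₁ + at λ′ i₂ + at λ′ i₃) + (col λ′ j₁ + col λ′ j₂ + col λ′ j₃)
    ≡⟨ cong₂ _+_ (∑-select₃ (at λ′) i₁<n i₂<n i₃<n) ∑-cols ⟨
  ∑ n (λ r → rows r * at λ′ r) + ∑ n (cols ∘ at λ′)
    ≡⟨ ∑-+ n _ _ ⟨
  ∑ n (λ r → rows r * at λ′ r + cols (at λ′ r))
    ≤⟨ ∑-mono-≤ n per-row ⟩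
  ∑ n (λ r → at λ′ r + rows r * 3)
    ≡⟨ ∑-+ n _ _ ⟩
  ∑ n (at λ′) + ∑ n (λ r → rows r * 3)
    ≡⟨ cong₂ _+_ (∑-at λ′) (∑-select₃ (λ _ → 3) i₁<n i₂<n i₃<n) ⟩
  ∣ λ′ ∣ + 9 ∎
  where
  open ≤-Reasoning
  n : ℕ
  n = length λ′
  i₂<n : i₂ < n
  i₂<n = <-trans i₂<i₃ i₃<n
  i₁<n : i₁ < n
  i₁<n = <-trans i₁<i₂ i₂<n
  rows : ℕ → ℕ
  rows r = ⟦ r ≟ i₁ ⟧ + ⟦ r ≟ i₂ ⟧ + ⟦ r ≟ i₃ ⟧
  cols : ℕ → ℕ
  cols x = ⟦ j₁ <? x ⟧ + ⟦ j₂ <? x ⟧ + ⟦ j₃ <? x ⟧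

  ∑-cols : ∑ n (cols ∘ at λ′) ≡ col λ′ j₁ + col λ′ j₂ + col λ′ j₃
  ∑-cols = trans (∑-+₃ n _ _ _) (cong₂ _+_ (cong₂ _+_ (∑-col λ′ j₁) (∑-col λ′ j₂)) (∑-col λ′ j₃))

  per-row : ∀ r → rows r * at λ′ r + cols (at λ′ r) ≤ at λ′ r + rows r * 3
  per-row r = bound {rows r} (multiplicity≤1 (<⇒≢ i₁<i₂) (<⇒≢ (<-trans i₁<i₂ i₂<i₃)) (<⇒≢ i₂<i₃) (r ≟ i₁) (r ≟ i₂) (r ≟ i₃))
                    (+-mono-≤ (+-mono-≤ (⟦⟧≤1 (j₁ <? x)) (⟦⟧≤1 (j₂ <? x))) (⟦⟧≤1 (j₃ <? x)))
                    (count-below≤ j₃<j₂ j₂<j₁ (j₁ <? x) (j₂ <? x) (j₃ <? x))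
    where
    x : ℕ
    x = at λ′ r
    bound : ∀ {s c} → s ≤ 1 → c ≤ 3 → c ≤ x → s * x + c ≤ x + s * 3
    bound {zero}     _ _   c≤x = ≤-trans c≤x (m≤m+n x 0)
    bound {suc zero} {c} _ c≤3 _ = subst (_≤ x + 3) (cong (_+ c) (sym (+-identityʳ x))) (+-monoʳ-≤ x c≤3)
    bound {suc (suc _)} (s≤s ())

-- hook-identity trades each hook length for a row and a column at the cost of iₖ + jₖ + 1, and
-- along a chain these offsets add up to at least 9, absorbing the 9 of rows+cols≤.
hook-sum-of-chain≤ : ∀ {λ′} → Linked _≥_ λ′ → ∀ {p₁ p₂ p₃} → Node λ′ p₁ → Node λ′ p₂ → Node λ′ p₃ →
                     p₁ ≺ p₂ → p₂ ≺ p₃ → hookAt λ′ p₁ + hookAt λ′ p₂ + hookAt λ′ p₃ ≤ ∣ λ′ ∣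
hook-sum-of-chain≤ {λ′} desc {i₁ , j₁} {i₂ , j₂} {i₃ , j₃} n₁ n₂ n₃ (i₁<i₂ , j₂<j₁) (i₂<i₃ , j₃<j₂) =
  +-cancelʳ-≤ 9 _ _ (begin
    h₁ + h₂ + h₃ + 9
      ≤⟨ +-monoʳ-≤ (h₁ + h₂ + h₃) (+-mono-≤ (+-mono-≤ 3≤o₁ 3≤o₂) 3≤o₃) ⟩
    h₁ + h₂ + h₃ + (o₁ + o₂ + o₃)
      ≡⟨ interchange₃ h₁ h₂ h₃ o₁ o₂ o₃ ⟨
    (h₁ + o₁) + (h₂ + o₂) + (h₃ + o₃)
      ≡⟨ cong₂ _+_ (cong₂ _+_ (hook-identity desc n₁) (hook-identity desc n₂)) (hook-identity desc n₃) ⟩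
    (at λ′ i₁ + col λ′ j₁) + (at λ′ i₂ + col λ′ j₂) + (at λ′ i₃ + col λ′ j₃)
      ≡⟨ interchange₃ (at λ′ i₁) (at λ′ i₂) (at λ′ i₃) (col λ′ j₁) (col λ′ j₂) (col λ′ j₃) ⟩
    (at λ′ i₁ + at λ′ i₂ + at λ′ i₃) + (col λ′ j₁ + col λ′ j₂ + col λ′ j₃)
      ≤⟨ rows+cols≤ λ′ i₁<i₂ i₂<i₃ (<at⇒<length λ′ n₃) j₃<j₂ j₂<j₁ ⟩
    ∣ λ′ ∣ + 9 ∎)
  where
  open ≤-Reasoning
  h₁ h₂ h₃ o₁ o₂ o₃ : ℕ
  h₁ = hook λ′ i₁ j₁
  h₂ = hook λ′ i₂ j₂
  h₃ = hook λ′ i₃ j₃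
  o₁ = suc (i₁ + j₁)
  o₂ = suc (i₂ + j₂)
  o₃ = suc (i₃ + j₃)
  interchange₃ : ∀ a b c x y z → (a + x) + (b + y) + (c + z) ≡ (a + b + c) + (x + y + z)
  interchange₃ = solve-∀
  1≤i₂ : 1 ≤ i₂
  1≤i₂ = <-≤-trans (s≤s z≤n) i₁<i₂
  1≤j₂ : 1 ≤ j₂
  1≤j₂ = <-≤-trans (s≤s z≤n) j₃<j₂
  3≤o₁ : 3 ≤ o₁
  3≤o₁ = s≤s (≤-trans (<-≤-trans (s≤s 1≤j₂) j₂<j₁) (m≤n+m j₁ i₁))
  3≤o₂ : 3 ≤ o₂
  3≤o₂ = s≤s (+-mono-≤ 1≤i₂ 1≤j₂)
  3≤o₃ : 3 ≤ o₃
  3≤o₃ = s≤s (≤-trans (<-≤-trans (s≤s 1≤i₂) i₂<i₃) (m≤m+n i₃ j₃))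

HasHook : List ℕ → ℕ → ℕ × ℕ → Set
HasHook λ′ q p = Node λ′ p × hookAt λ′ p ≡ q

three-hooks-of-length≤ : ∀ {λ′} → Linked _≥_ λ′ → ∀ {q p₁ p₂ p₃} →
                         HasHook λ′ q p₁ → HasHook λ′ q p₂ → HasHook λ′ q p₃ →
                         p₁ ≢ p₂ → p₂ ≢ p₃ → p₁ ≢ p₃ → q + q + q ≤ ∣ λ′ ∣
three-hooks-of-length≤ {λ′} desc {q} h₁@(n₁ , h₁≡q) h₂@(n₂ , h₂≡q) h₃@(n₃ , h₃≡q) p₁≢p₂ p₂≢p₃ p₁≢p₃ =
  wlog-chain₃ {_⊏_ = _≺_} sorted h₁ h₂ h₃
    (≡-hook⇒≺⊎≻ desc n₁ n₂ (trans h₁≡q (sym h₂≡q)) p₁≢p₂)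
    (≡-hook⇒≺⊎≻ desc n₂ n₃ (trans h₂≡q (sym h₃≡q)) p₂≢p₃)
    (≡-hook⇒≺⊎≻ desc n₁ n₃ (trans h₁≡q (sym h₃≡q)) p₁≢p₃)
  where
  sorted : ∀ {x y z} → HasHook λ′ q x → HasHook λ′ q y → HasHook λ′ q z → x ≺ y → y ≺ z → q + q + q ≤ ∣ λ′ ∣
  sorted (nx , hx) (ny , hy) (nz , hz) x≺y y≺z =
    subst (_≤ ∣ λ′ ∣) (cong₂ _+_ (cong₂ _+_ hx hy) hz) (hook-sum-of-chain≤ desc nx ny nz x≺y y≺z)

sum-filter-positive : ∀ xs → sum (filter (0 <?_) xs) ≡ sum xs
sum-filter-positive []           = refl
sum-filter-positive (zero  ∷ xs) = sum-filter-positive xs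
sum-filter-positive (suc x ∷ xs) = cong (suc x +_) (sum-filter-positive xs)

module RimRemoval {λ′ : List ℕ} (desc : Linked _≥_ λ′) {i j : ℕ} (node : Node λ′ (i , j)) where

  L n : ℕ
  L = leg λ′ i j
  n = length λ′

  row : ℕ → ℕ
  row r = if r <ᵇ i then at λ′ r
          else if r <ᵇ i + L then at λ′ (suc r) ∸ 1
          else if r ≡ᵇ i + L then j
          else at λ′ r

  removeRim≡ : removeRim λ′ i j ≡ filter (0 <?_) (map row (upTo n))
  removeRim≡ = refl

  foot : ℕ
  foot = i + L

  suc-foot≡col : suc foot ≡ col λ′ j
  suc-foot≡col = begin
    suc (i + L) ≡⟨ cong suc (+-comm i L) ⟩
    suc (L + i) ≡⟨ +-suc L i ⟨
    L + suc i   ≡⟨ m∸n+n≡m (<at⇒<col desc node) ⟩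
    col λ′ j    ∎
    where open ≡-Reasoning

  in-column : ∀ {r} → r ≤ foot → j < at λ′ r
  in-column r≤foot = <col⇒<at desc (subst (_ <_) suc-foot≡col (s≤s r≤foot))

  data Position (r : ℕ) : Set where
    above : r < i → Position r
    strip : i ≤ r → r < foot → Position r
    at-foot : r ≡ foot → Position r
    below : foot < r → Position r

  position : ∀ r → Position r
  position r with r <? i | r <? foot | r ≟ foot
  ... | yes r<i | _ | _ = above r<i
  ... | no r≮i | yes r<foot | _ = strip (≮⇒≥ r≮i) r<foot
  ... | no _   | no _ | yes r≡foot = at-foot r≡foot
  ... | no _   | no r≮foot | no r≢foot = below (≤∧≢⇒< (≮⇒≥ r≮foot) (r≢foot ∘ sym))

  row-above : ∀ {r} → r < i → row r ≡ at λ′ r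
  row-above r<i rewrite <ᵇ-true r<i = refl

  row-strip : ∀ {r} → i ≤ r → r < foot → row r ≡ at λ′ (suc r) ∸ 1
  row-strip i≤r r<foot rewrite <ᵇ-false i≤r | <ᵇ-true r<foot = refl

  row-foot : row foot ≡ j
  row-foot rewrite <ᵇ-false (m≤m+n i L) | <ᵇ-false (≤-refl {foot}) | dec-true (foot ≟ foot) refl = refl

  row-below : ∀ {r} → foot < r → row r ≡ at λ′ r
  row-below {r} foot<r rewrite <ᵇ-false (≤-trans (m≤m+n i L) (<⇒≤ foot<r)) | <ᵇ-false (<⇒≤ foot<r)
                             | dec-false (r ≟ foot) (>⇒≢ foot<r) = refl

  row≤at : ∀ r → row r ≤ at λ′ r
  row≤at r with position r
  ... | above r<i         = ≤-reflexive (row-above r<i)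
  ... | strip i≤r r<foot  = begin
    row r                 ≡⟨ row-strip i≤r r<foot ⟩
    at λ′ (suc r) ∸ 1     ≤⟨ m∸n≤m _ 1 ⟩
    at λ′ (suc r)         ≤⟨ at-antitone desc (n≤1+n r) ⟩
    at λ′ r               ∎
    where open ≤-Reasoning
  ... | at-foot refl      = ≤-trans (≤-reflexive row-foot) (<⇒≤ (in-column ≤-refl))
  ... | below foot<r      = ≤-reflexive (row-below foot<r)

  row-antitone : ∀ r → row (suc r) ≤ row r
  row-antitone r with position r
  ... | above r<i = begin
    row (suc r)   ≤⟨ row≤at (suc r) ⟩
    at λ′ (suc r) ≤⟨ at-antitone desc (n≤1+n r) ⟩
    at λ′ r       ≡⟨ row-above r<i ⟨
    row r         ∎
    where open ≤-Reasoning
  ... | strip i≤r r<foot with m≤n⇒m<n∨m≡n r<foot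
  ...   | inj₁ r+1<foot = begin
    row (suc r)             ≡⟨ row-strip (m≤n⇒m≤1+n i≤r) r+1<foot ⟩
    at λ′ (suc (suc r)) ∸ 1 ≤⟨ ∸-monoˡ-≤ 1 (at-antitone desc (n≤1+n (suc r))) ⟩
    at λ′ (suc r) ∸ 1       ≡⟨ row-strip i≤r r<foot ⟨
    row r                   ∎
    where open ≤-Reasoning
  ...   | inj₂ r+1≡foot = begin
    row (suc r)       ≡⟨ trans (cong row r+1≡foot) row-foot ⟩
    j                 ≤⟨ <⇒≤pred (in-column (≤-reflexive r+1≡foot)) ⟩
    at λ′ (suc r) ∸ 1 ≡⟨ row-strip i≤r r<foot ⟨
    row r             ∎
    where open ≤-Reasoning
  row-antitone r | at-foot refl = begin
    row (suc foot)   ≡⟨ row-below ≤-refl ⟩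
    at λ′ (suc foot) ≤⟨ ≮⇒≥ (λ j<at → <-irrefl suc-foot≡col (<at⇒<col desc j<at)) ⟩
    j                ≡⟨ row-foot ⟨
    row foot         ∎
    where open ≤-Reasoning
  row-antitone r | below foot<r = begin
    row (suc r)   ≡⟨ row-below (m<n⇒m<1+n foot<r) ⟩
    at λ′ (suc r) ≤⟨ at-antitone desc (n≤1+n r) ⟩
    at λ′ r       ≡⟨ row-below foot<r ⟨
    row r         ∎
    where open ≤-Reasoning

  removeRim-isPartition : IsPartition (removeRim λ′ i j)
  removeRim-isPartition = Linked.filter⁺ (0 <?_) (flip ≤-trans) rows-antitone , All.all-filter (0 <?_) (map row (upTo n))
    where
    rows-antitone : Linked _≥_ (map row (upTo n))
    rows-antitone = subst (Linked _≥_) (sym (map-upTo row n)) (Linked.applyUpTo⁺₂ row n row-antitone)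

  m : ℕ
  m = n ∸ col λ′ j

  length≡ : n ≡ i + suc (L + m)
  length≡ = begin
    n                 ≡⟨ m+[n∸m]≡n (length-filter (j <?_) λ′) ⟨
    col λ′ j + m      ≡⟨ cong (_+ m) suc-foot≡col ⟨
    suc (i + L) + m   ≡⟨ cong (_+ m) (+-suc i L) ⟨
    i + suc L + m     ≡⟨ +-assoc i (suc L) m ⟩
    i + suc (L + m)   ∎
    where open ≡-Reasoning

  strip-row : ℕ → ℕ
  strip-row k = at λ′ (i + suc k)

  lower-row : ℕ → ℕ
  lower-row k = at λ′ (i + suc (L + k))

  ∑-row : ∑ n row ≡ ∑ i (at λ′) + (∑ L (λ k → strip-row k ∸ 1) + (j + ∑ m lower-row))
  ∑-row = begin
    ∑ n row
      ≡⟨ cong (λ n → ∑ n row) (trans length≡ (cong (i +_) (sym (+-suc L m)))) ⟩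
    ∑ (i + (L + suc m)) row
      ≡⟨ ∑-split i _ row ⟩
    ∑ i row + ∑ (L + suc m) (λ k → row (i + k))
      ≡⟨ cong (∑ i row +_) (∑-split L (suc m) _) ⟩
    ∑ i row + (∑ L (λ k → row (i + k)) + (row (i + (L + 0)) + ∑ m (λ k → row (i + (L + suc k)))))
      ≡⟨ cong₂ _+_ (∑-cong i row-above)
                   (cong₂ _+_ (∑-cong L in-strip) (cong₂ _+_ (trans (cong (λ k → row (i + k)) (+-identityʳ L)) row-foot)
                                                            (∑-cong m in-lower))) ⟩
    ∑ i (at λ′) + (∑ L (λ k → strip-row k ∸ 1) + (j + ∑ m lower-row)) ∎
    where
    open ≡-Reasoning
    in-strip : ∀ {k} → k < L → row (i + k) ≡ strip-row k ∸ 1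
    in-strip {k} k<L = trans (row-strip (m≤m+n i k) (+-monoʳ-< i k<L)) (cong (λ r → at λ′ r ∸ 1) (sym (+-suc i k)))
    in-lower : ∀ {k} → k < m → row (i + (L + suc k)) ≡ lower-row k
    in-lower {k} _ = trans (row-below (+-monoʳ-< i (m<m+n L (s≤s z≤n)))) (cong (λ s → at λ′ (i + s)) (+-suc L k))

  ∑-at-split : ∑ n (at λ′) ≡ ∑ i (at λ′) + (at λ′ i + (∑ L strip-row + ∑ m lower-row))
  ∑-at-split = begin
    ∑ n (at λ′)
      ≡⟨ cong (λ n → ∑ n (at λ′)) length≡ ⟩
    ∑ (i + suc (L + m)) (at λ′)
      ≡⟨ ∑-split i _ (at λ′) ⟩
    ∑ i (at λ′) + (at λ′ (i + 0) + ∑ (L + m) strip-row)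
      ≡⟨ cong (∑ i (at λ′) +_) (cong₂ _+_ (cong (at λ′) (+-identityʳ i)) (∑-split L m strip-row)) ⟩
    ∑ i (at λ′) + (at λ′ i + (∑ L strip-row + ∑ m lower-row)) ∎
    where open ≡-Reasoning

  removeRim-size : ∣ removeRim λ′ i j ∣ + hook λ′ i j ≡ ∣ λ′ ∣
  removeRim-size = begin
    ∣ removeRim λ′ i j ∣ + hook λ′ i j
      ≡⟨ cong (λ δ → ∣ δ ∣ + hook λ′ i j) removeRim≡ ⟩
    sum (filter (0 <?_) (map row (upTo n))) + suc (A + L)
      ≡⟨ cong (_+ suc (A + L)) (trans (sum-filter-positive (map row (upTo n))) (cong sum (map-upTo row n))) ⟩
    ∑ n row + suc (A + L)
      ≡⟨ cong (_+ suc (A + L)) ∑-row ⟩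
    S + (P + (j + Q)) + suc (A + L)
      ≡⟨ regroup S P j Q A L ⟩
    S + ((A + suc j) + ((P + L) + Q))
      ≡⟨ cong (S +_) (cong₂ _+_ (m∸n+n≡m node) (cong (_+ Q) (∑-pred L strip-row strip-row>0))) ⟩
    S + (at λ′ i + (∑ L strip-row + Q))
      ≡⟨ ∑-at-split ⟨
    ∑ n (at λ′)
      ≡⟨ ∑-at λ′ ⟩
    ∣ λ′ ∣ ∎
    where
    open ≡-Reasoning
    S P Q A : ℕ
    S = ∑ i (at λ′)
    P = ∑ L (λ k → strip-row k ∸ 1)
    Q = ∑ m lower-row
    A = arm λ′ i j
    regroup : ∀ S P j Q A L → S + (P + (j + Q)) + suc (A + L) ≡ S + ((A + suc j) + ((P + L) + Q))
    regroup = solve-∀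
    strip-row>0 : ∀ {k} → k < L → 0 < strip-row k
    strip-row>0 {k} k<L = <-≤-trans (s≤s z≤n) (in-column (≤-trans (≤-reflexive (+-suc i k)) (+-monoʳ-< i k<L)))

nodesInRow : List ℕ → ℕ → List (ℕ × ℕ)
nodesInRow λ′ i = map (i ,_) (upTo (at λ′ i))

∈-nodesInRow⁻ : ∀ {λ′ i p} → p ∈ nodesInRow λ′ i → proj₁ p ≡ i × Node λ′ p
∈-nodesInRow⁻ {λ′} {i} p∈row with ∈-map⁻ (i ,_) p∈row
... | _ , j∈upTo , refl = refl , ∈-upTo⁻ j∈upTo

∈-nodes⁺ : ∀ {λ′ p} → Node λ′ p → p ∈ nodes λ′
∈-nodes⁺ {λ′} {i , j} node =
  ∈-concatMap⁺ (nodesInRow λ′) (lose (∈-upTo⁺ (<at⇒<length λ′ node)) (∈-map⁺ (i ,_) (∈-upTo⁺ node)))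

∈-nodes⁻ : ∀ {λ′ p} → p ∈ nodes λ′ → Node λ′ p
∈-nodes⁻ {λ′} p∈nodes with find (∈-concatMap⁻ (nodesInRow λ′) {upTo (length λ′)} p∈nodes)
... | _ , _ , p∈row = proj₂ (∈-nodesInRow⁻ {λ′} p∈row)

nodes-unique : ∀ λ′ → Unique (nodes λ′)
nodes-unique λ′ = Unique.concat⁺ (subst (All Unique) (sym (map-upTo (nodesInRow λ′) n)) rows-unique)
                                  (subst (AllPairs Disjoint) (sym (map-upTo (nodesInRow λ′) n)) rows-disjoint)
  where
  n : ℕ
  n = length λ′
  rows-unique : All Unique (applyUpTo (nodesInRow λ′) n)
  rows-unique = All.applyUpTo⁺₂ _ n (λ i → Unique.map⁺ (cong proj₂) (Unique.upTo⁺ (at λ′ i)))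
  rows-disjoint : AllPairs Disjoint (applyUpTo (nodesInRow λ′) n)
  rows-disjoint = AllPairs.applyUpTo⁺₁ _ n λ i<i′ _ (v∈row , v∈row′) →
    <⇒≢ i<i′ (trans (sym (proj₁ (∈-nodesInRow⁻ {λ′} v∈row))) (proj₁ (∈-nodesInRow⁻ {λ′} v∈row′)))

nodesWithHook : List ℕ → ℕ → List (ℕ × ℕ)
nodesWithHook λ′ q = filter (λ p → hookAt λ′ p ≟ q) (nodes λ′)

∈-nodesWithHook⁺ : ∀ {λ′ q p} → Node λ′ p → hookAt λ′ p ≡ q → p ∈ nodesWithHook λ′ q
∈-nodesWithHook⁺ {λ′} {q} node hook≡q = ∈-filter⁺ (λ p → hookAt λ′ p ≟ q) (∈-nodes⁺ {λ′} node) hook≡q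

∈-nodesWithHook⁻ : ∀ {λ′ q p} → p ∈ nodesWithHook λ′ q → HasHook λ′ q p
∈-nodesWithHook⁻ {λ′} {q} p∈ with ∈-filter⁻ (λ p → hookAt λ′ p ≟ q) {xs = nodes λ′} p∈
... | p∈nodes , hook≡q = ∈-nodes⁻ {λ′} p∈nodes , hook≡q

nodesWithHook-unique : ∀ λ′ q → Unique (nodesWithHook λ′ q)
nodesWithHook-unique λ′ q = Unique.filter⁺ (λ p → hookAt λ′ p ≟ q) (nodes-unique λ′)

module _ {a} {A : Set a} where

  two-distinct : ∀ {xs : List A} → Unique xs → 2 ≤ length xs → Σ[ x ∈ A ] Σ[ y ∈ A ] x ∈ xs × y ∈ xs × x ≢ y
  two-distinct ((x≢y ∷ _) ∷ _) (s≤s (s≤s z≤n)) = _ , _ , here refl , there (here refl) , x≢y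

  three-distinct : ∀ {xs : List A} → Unique xs → 3 ≤ length xs →
                   Σ[ x ∈ A ] Σ[ y ∈ A ] Σ[ z ∈ A ] x ∈ xs × y ∈ xs × z ∈ xs × x ≢ y × y ≢ z × x ≢ z
  three-distinct ((x≢y ∷ x≢z ∷ _) ∷ (y≢z ∷ _) ∷ _) (s≤s (s≤s (s≤s z≤n))) =
    _ , _ , _ , here refl , there (here refl) , there (there (here refl)) , x≢y , y≢z , x≢z

length-nodesWithHook≤2 : ∀ {λ′ q} → Linked _≥_ λ′ → ∣ λ′ ∣ < q + q + q → length (nodesWithHook λ′ q) ≤ 2
length-nodesWithHook≤2 {λ′} {q} desc ∣λ′∣<3q = ≮⇒≥ λ 3≤length →
  let x , y , z , x∈ , y∈ , z∈ , x≢y , y≢z , x≢z = three-distinct (nodesWithHook-unique λ′ q) 3≤length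
  in <⇒≱ ∣λ′∣<3q (three-hooks-of-length≤ desc (∈-nodesWithHook⁻ {λ′} x∈) (∈-nodesWithHook⁻ {λ′} y∈)
                                                (∈-nodesWithHook⁻ {λ′} z∈) x≢y y≢z x≢z)

sumℤ : List ℤ → ℤ
sumℤ = foldr ℤ._+_ 0ℤ

sumℤ-map-if : ∀ {a p} {A : Set a} {P : A → Set p} (P? : ∀ x → Dec (P x)) (f : A → ℤ) xs →
              sumℤ (map (λ x → if does (P? x) then f x else 0ℤ) xs) ≡ sumℤ (map f (filter P? xs))
sumℤ-map-if P? f []       = refl
sumℤ-map-if P? f (x ∷ xs) with does (P? x)
... | true  = cong (λ s → f x ℤ.+ s) (sumℤ-map-if P? f xs)
... | false = trans (ℤ.+-identityˡ _) (sumℤ-map-if P? f xs)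

rimTerm : List ℕ → List ℕ → ℕ × ℕ → ℤ
rimTerm λ′ μ (i , j) = sign (leg λ′ i j) ℤ.* χ (removeRim λ′ i j) μ

χ-∷ : ∀ λ′ q μ → χ λ′ (q ∷ μ) ≡ sumℤ (map (rimTerm λ′ μ) (nodesWithHook λ′ q))
χ-∷ λ′ q μ = sumℤ-map-if (λ p → hookAt λ′ p ≟ q) (rimTerm λ′ μ) (nodes λ′)

χ≢0⇒hook : ∀ λ′ q μ → χ λ′ (q ∷ μ) ≢ 0ℤ → Σ[ p ∈ ℕ × ℕ ] HasHook λ′ q p
χ≢0⇒hook λ′ q μ χ≢0 with nodesWithHook λ′ q in eq | χ-∷ λ′ q μ
... | []    | χ≡0 = ⊥-elim (χ≢0 χ≡0)
... | p ∷ _ | _   = p , ∈-nodesWithHook⁻ {λ′} (subst (p ∈_) (sym eq) (here refl))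

InSign-neg : ∀ {v} → InSign v → InSign (ℤ.- v)
InSign-neg (inj₁ refl)        = inj₁ refl
InSign-neg (inj₂ (inj₁ refl)) = inj₂ (inj₂ refl)
InSign-neg (inj₂ (inj₂ refl)) = inj₂ (inj₁ refl)

InSign-sign* : ∀ n {v} → InSign v → InSign (sign n ℤ.* v)
InSign-sign* zero    {v} v∈ = subst InSign (sym (ℤ.*-identityˡ v)) v∈
InSign-sign* (suc n) {v} v∈ = subst InSign (ℤ.neg-distribˡ-* (sign n) v) (InSign-neg (InSign-sign* n v∈))

module _ {a} {A : Set a} {f : A → ℤ} where

  InSign-sumℤ≤1 : ∀ {xs} → All (InSign ∘ f) xs → length xs ≤ 1 → InSign (sumℤ (map f xs))
  InSign-sumℤ≤1 []              _ = inj₁ refl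
  InSign-sumℤ≤1 {x ∷ _} (x∈ ∷ []) _ = subst InSign (sym (ℤ.+-identityʳ (f x))) x∈
  InSign-sumℤ≤1 (_ ∷ _ ∷ _) (s≤s ())

  InSign-sumℤ≤2 : ∀ {xs} → All (InSign ∘ f) xs → length xs ≤ 2 → Any (λ x → f x ≡ 0ℤ) xs →
                  InSign (sumℤ (map f xs))
  InSign-sumℤ≤2 (x∈ ∷ []) _ _ = InSign-sumℤ≤1 (x∈ ∷ []) ≤-refl
  InSign-sumℤ≤2 {x ∷ y ∷ []} (_ ∷ y∈ ∷ []) _ (here fx≡0) =
    subst InSign (sym (trans (cong (ℤ._+ (f y ℤ.+ 0ℤ)) fx≡0) (ℤ.+-identityˡ _))) (InSign-sumℤ≤1 (y∈ ∷ []) ≤-refl)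
  InSign-sumℤ≤2 {x ∷ y ∷ []} (x∈ ∷ _ ∷ []) _ (there (here fy≡0)) =
    subst InSign (sym (cong (λ v → f x ℤ.+ (v ℤ.+ 0ℤ)) fy≡0)) (InSign-sumℤ≤1 (x∈ ∷ []) ≤-refl)
  InSign-sumℤ≤2 (_ ∷ _ ∷ _ ∷ _) (s≤s (s≤s ())) _

rimTerms-InSign : ∀ {λ′ q μ} → SignPartition μ → IsPartition λ′ → ∣ λ′ ∣ ≡ q + ∣ μ ∣ →
                  All (InSign ∘ rimTerm λ′ μ) (nodesWithHook λ′ q)
rimTerms-InSign {λ′} {q} {μ} (_ , μ-sign) (desc , _) ∣λ′∣≡ = All.tabulate term-InSign
  where
  term-InSign : ∀ {p} → p ∈ nodesWithHook λ′ q → InSign (rimTerm λ′ μ p)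
  term-InSign {i , j} p∈ with ∈-nodesWithHook⁻ {λ′} p∈
  ... | node , hook≡q = InSign-sign* (leg λ′ i j) (μ-sign _ removeRim-isPartition ∣δ∣≡∣μ∣)
    where
    open RimRemoval desc node
    ∣δ∣≡∣μ∣ : ∣ removeRim λ′ i j ∣ ≡ ∣ μ ∣
    ∣δ∣≡∣μ∣ = +-cancelʳ-≡ q _ _ (begin
      ∣ removeRim λ′ i j ∣ + q            ≡⟨ cong (∣ removeRim λ′ i j ∣ +_) hook≡q ⟨
      ∣ removeRim λ′ i j ∣ + hook λ′ i j  ≡⟨ removeRim-size ⟩
      ∣ λ′ ∣                              ≡⟨ ∣λ′∣≡ ⟩
      q + ∣ μ ∣                           ≡⟨ +-comm q ∣ μ ∣ ⟩
      ∣ μ ∣ + q                           ∎)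
      where open ≡-Reasoning

module _ {λ′ q μ} (μ-sign : SignPartition μ) (λ′-partition : IsPartition λ′) (∣λ′∣≡ : ∣ λ′ ∣ ≡ q + ∣ μ ∣)
         (χ∉sign : ¬ InSign (χ λ′ (q ∷ μ))) where

  private
    terms-InSign : All (InSign ∘ rimTerm λ′ μ) (nodesWithHook λ′ q)
    terms-InSign = rimTerms-InSign μ-sign λ′-partition ∣λ′∣≡

    sum∉sign : ¬ InSign (sumℤ (map (rimTerm λ′ μ) (nodesWithHook λ′ q)))
    sum∉sign = χ∉sign ∘ subst InSign (sym (χ-∷ λ′ q μ))

  χ∉sign⇒two-hooks : Σ[ p ∈ ℕ × ℕ ] Σ[ p′ ∈ ℕ × ℕ ]
                       Node λ′ p × Node λ′ p′ × p ≢ p′ × hookAt λ′ p ≡ q × hookAt λ′ p′ ≡ q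
  χ∉sign⇒two-hooks with two-distinct (nodesWithHook-unique λ′ q) (≰⇒> (sum∉sign ∘ InSign-sumℤ≤1 terms-InSign))
  ... | p , p′ , p∈ , p′∈ , p≢p′ with ∈-nodesWithHook⁻ {λ′} p∈ | ∈-nodesWithHook⁻ {λ′} p′∈
  ...   | node , hook≡q | node′ , hook′≡q = p , p′ , node , node′ , p≢p′ , hook≡q , hook′≡q

  χ∉sign⇒χ-removeRim≢0 : ∣ λ′ ∣ < q + q + q → ∀ p → Node λ′ p → hookAt λ′ p ≡ q → χ (removeAt λ′ p) μ ≢ 0ℤ
  χ∉sign⇒χ-removeRim≢0 ∣λ′∣<3q p@(i , j) node hook≡q χδ≡0 =
    sum∉sign (InSign-sumℤ≤2 terms-InSign (length-nodesWithHook≤2 (proj₁ λ′-partition) ∣λ′∣<3q)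
                            (lose (∈-nodesWithHook⁺ {λ′} node hook≡q) term≡0))
    where
    term≡0 : rimTerm λ′ μ p ≡ 0ℤ
    term≡0 = trans (cong (sign (leg λ′ i j) ℤ.*_) χδ≡0) (ℤ.*-zeroʳ (sign (leg λ′ i j)))

∣a∷a∸1∷rest∣<3a : ∀ {a} rest → 1 ≤ a → ∣ rest ∣ ≤ a → ∣ a ∷ (a ∸ 1) ∷ rest ∣ < a + a + a
∣a∷a∸1∷rest∣<3a {a} rest 1≤a ∣rest∣≤a = begin-strict
  a + (a ∸ 1 + ∣ rest ∣)  <⟨ +-monoʳ-< a (+-mono-<-≤ (∸-monoʳ-< {a} (s≤s z≤n) 1≤a) ∣rest∣≤a) ⟩
  a + (a + a)             ≡⟨ +-assoc a a a ⟨
  a + a + a               ∎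
  where open ≤-Reasoning

lemma3 : (a : ℕ) → 2 ≤ a → (rest : List ℕ) →
    IsPartition (a ∷ (a ∸ 1) ∷ rest) →
    SignPartition ((a ∸ 1) ∷ rest) →
    ∣ rest ∣ ≤ a →
    (β : List ℕ) → IsPartition β → ∣ β ∣ ≡ ∣ a ∷ (a ∸ 1) ∷ rest ∣ →
    ¬ InSign (χ β (a ∷ (a ∸ 1) ∷ rest)) →
    (Σ[ p ∈ ℕ × ℕ ] Σ[ q ∈ ℕ × ℕ ]
        Node β p × Node β q × ¬ p ≡ q
        × hookAt β p ≡ a × hookAt β q ≡ a)
    × ((p : ℕ × ℕ) → Node β p → hookAt β p ≡ a →
        ¬ χ (removeAt β p) ((a ∸ 1) ∷ rest) ≡ 0ℤ
        × (Σ[ r ∈ ℕ × ℕ ] Node (removeAt β p) r × hookAt (removeAt β p) r ≡ a ∸ 1))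
lemma3 a 2≤a rest _ γ′-sign ∣rest∣≤a β β-partition ∣β∣≡ χ∉sign =
  χ∉sign⇒two-hooks γ′-sign β-partition ∣β∣≡ χ∉sign , removal
  where
  ∣β∣<3a : ∣ β ∣ < a + a + a
  ∣β∣<3a = subst (_< a + a + a) (sym ∣β∣≡) (∣a∷a∸1∷rest∣<3a rest (<-≤-trans (s≤s z≤n) 2≤a) ∣rest∣≤a)

  removal : ∀ p → Node β p → hookAt β p ≡ a →
            χ (removeAt β p) ((a ∸ 1) ∷ rest) ≢ 0ℤ × Σ[ r ∈ ℕ × ℕ ] HasHook (removeAt β p) (a ∸ 1) r
  removal p node hook≡a = χδ≢0 , χ≢0⇒hook (removeAt β p) (a ∸ 1) rest χδ≢0
    where
    χδ≢0 : χ (removeAt β p) ((a ∸ 1) ∷ rest) ≢ 0ℤ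
    χδ≢0 = χ∉sign⇒χ-removeRim≢0 γ′-sign β-partition ∣β∣≡ χ∉sign ∣β∣<3a p node hook≡a
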